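{- For $n\ge1$ and nonnegative integers $i,j,k$, let $\gamma_{n,i,j,k}$ denote the number of 0-1-2-3 increasing plane trees on $[n]$ with $k$ leaves, $j$ vertices of degree one and $i$ vertices of degree two (equivalently, the coefficient of $(x+y+z)^i(xy+xz+yz)^j(xyz)^k$ in the expansion of $C_n(x,y,z)$ in elementary symmetric functions), with $\gamma_{n,i,j,k}=0$ whenever any index is negative. Then $\gamma_{1,0,0,1}=1$, $\gamma_{1,i,j,k}=0$ for $k\ne1$, and for $n\ge2$, $$\gamma_{n,i,j,k}=3(i+1)\gamma_{n-1,i+1,j,k-1}+2(j+1)\gamma_{n-1,i-1,j+1,k-1}+k\,\gamma_{n-1,i,j-1,k}.$$
   Context: An increasing plane tree on $[n]$ is a rooted plane (children ordered) tree with vertex set $[n]$ whose labels increase along every path from the root; it is a 0-1-2-3 increasing plane tree if every vertex has at most three children. The degree of a vertex is its number of children; a leaf has degree zero. $C_n(x,y,z)=\sum_{\sigma\in Q_n}x^{\mathrm{des}(\sigma)}y^{\mathrm{asc}(\sigma)}z^{\mathrm{plat}(\sigma)}$, where $Q_n$ is the set of Stirling permutations of $\{1,1,\dots,n,n\}$ (each $j$ appears twice and entries between the two $j$'s exceed $j$), with $\sigma_0=\sigma_{2n+1}=0$ and descents $\sigma_i>\sigma_{i+1}$, ascents $\sigma_{i-1}<\sigma_i$, plateaux $\sigma_i=\sigma_{i+1}$ for $1\le i\le 2n$. -}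

module Defs where

open import Data.Bool using (Bool; true; false; _∧_; if_then_else_)
open import Data.Nat using (ℕ; zero; suc; _≡ᵇ_; _<ᵇ_)
open import Data.Fin using (Fin; toℕ)
open import Data.List using (List; []; _∷_; [_]; _++_; map; concat; concatMap; allFin; filterᵇ; length; foldr)
open import Data.Vec using (Vec; lookup; toList) renaming ([] to []ᵥ; _∷_ to _∷ᵥ_)
open import Data.Integer using (ℤ; +_; -[1+_])

all : {A : Set} → (A → Bool) → List A → Bool
all p = foldr (λ x b → p x ∧ b) true

-- Encoding of a 0-1-2-3 increasing plane tree on [n] (vertex v : Fin n stands
-- for the label toℕ v + 1): for every vertex its ordered list of children.

lists≤3 : (n : ℕ) → List (List (Fin n))
lists≤3 n =
  [] ∷ (map [_] fs
       ++ concatMap (λ a → map (λ b → a ∷ b ∷ []) fs) fs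
       ++ concatMap (λ a → concatMap (λ b → map (λ c → a ∷ b ∷ c ∷ []) fs) fs) fs)
  where fs = allFin n

vecs : {A : Set} (m : ℕ) → List A → List (Vec A m)
vecs zero    xs = []ᵥ ∷ []
vecs (suc m) xs = concatMap (λ x → map (x ∷ᵥ_) (vecs m xs)) xs

candidates : (n : ℕ) → List (Vec (List (Fin n)) n)
candidates n = vecs n (lists≤3 n)

occ : {n : ℕ} → Fin n → List (Fin n) → ℕ
occ w xs = length (filterᵇ (λ u → toℕ u ≡ᵇ toℕ w) xs)

increasingᵇ : {n : ℕ} → Vec (List (Fin n)) n → Bool
increasingᵇ {n} c = all (λ v → all (λ w → toℕ v <ᵇ toℕ w) (lookup c v)) (allFin n)

-- Together with increasingᵇ this says exactly that the child lists form a
-- rooted plane tree on [n], rooted at 1, with increasing labels.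
parentsᵇ : {n : ℕ} → Vec (List (Fin n)) n → Bool
parentsᵇ {n} c =
  all (λ w → occ w (concat (toList c)) ≡ᵇ (if toℕ w ≡ᵇ 0 then 0 else 1)) (allFin n)

isTreeᵇ : {n : ℕ} → Vec (List (Fin n)) n → Bool
isTreeᵇ c = increasingᵇ c ∧ parentsᵇ c

degCount : {n : ℕ} → ℕ → Vec (List (Fin n)) n → ℕ
degCount d c = length (filterᵇ (λ l → length l ≡ᵇ d) (toList c))

γ : ℕ → ℕ → ℕ → ℕ → ℕ
γ n i j k = length (filterᵇ
  (λ c → isTreeᵇ c ∧ (degCount 0 c ≡ᵇ k) ∧ (degCount 1 c ≡ᵇ j) ∧ (degCount 2 c ≡ᵇ i))
  (candidates n))

γℤ : ℕ → ℤ → ℤ → ℤ → ℕ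
γℤ n (+ i) (+ j) (+ k) = γ n i j k
γℤ n _     _     _     = 0

module Submission where

-- The largest label n of an increasing tree on [n] is a leaf, and deleting it leaves an increasing
-- tree on [n − 1]; conversely n can be attached to any vertex of degree d ≤ 2 in any of its d + 1
-- gaps between children, and the two operations are mutually inverse.  Counting in the smaller
-- tree, attaching to one of its k leaves keeps the number of leaves and creates a vertex of degree
-- one; attaching to one of its j + 1 vertices of degree one (two gaps) turns it into a vertex of
-- degree two and adds a leaf; attaching to one of its i + 1 vertices of degree two (three gaps)
-- removes a vertex of degree two and adds a leaf.  Summing over the trees on [n − 1] gives the
-- recurrence.

open import Defs
open import Data.Bool using (Bool; true; false; _∧_; if_then_else_)
open import Data.Bool.Properties using (T?; T-≡; ∧-zeroʳ)
open import Data.Empty using (⊥-elim)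
open import Data.Fin using (Fin; toℕ; fromℕ<) renaming (zero to fzero; suc to fsuc)
open import Data.Fin.Properties using (toℕ-injective; toℕ<n; toℕ-fromℕ<)
open import Data.Integer using (+_) renaming (_-_ to _-ℤ_)
open import Data.List
  using (List; []; _∷_; [_]; _++_; _∷ʳ_; map; concat; concatMap; filterᵇ; length; allFin; tabulate; head; drop; null;
         initLast; _∷ʳ′_)
open import Data.List.Properties
  using (length-++; length-map; filter-++; map-injective; ∷-injectiveˡ; ∷-injectiveʳ; concat-map; concat-++; ++-identityʳ;
         ++-assoc; ++-cancelʳ; length-++-sucʳ)
open import Data.List.Membership.Propositional using (_∈_; find; lose)
open import Data.List.Membership.Propositional.Properties
  using (∈-map⁺; ∈-map⁻; ∈-++⁺ˡ; ∈-++⁺ʳ; ∈-++⁻; ∈-concatMap⁺; ∈-concatMap⁻; ∈-filter⁺; ∈-filter⁻;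
         ∈-allFin)
open import Data.List.Membership.Propositional.Properties.WithK using (unique∧set⇒bag)
open import Data.List.Relation.Binary.BagAndSetEquality using (∼bag⇒↭)
open import Data.List.Relation.Binary.Disjoint.Propositional using (Disjoint)
open import Data.List.Relation.Binary.Permutation.Propositional.Properties using (↭-length)
open import Data.List.Relation.Unary.All as All using (All; []; _∷_)
import Data.List.Relation.Unary.All.Properties as All
open import Data.List.Relation.Unary.AllPairs using ([]; _∷_)
open import Data.List.Relation.Unary.Any using (here; there)
open import Data.List.Relation.Unary.Unique.Propositional using (Unique)
import Data.List.Relation.Unary.Unique.Propositional.Properties as Unique
open import Data.Maybe using (Maybe; just)
open import Data.Maybe.Properties using (just-injective)
open import Data.Nat using (ℕ; zero; suc; _+_; _*_; _∸_; _≤_; _<_; z≤n; s≤s; s≤s⁻¹; _≡ᵇ_; _<ᵇ_; _≤ᵇ_)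
open import Data.Nat.Properties
open import Data.Nat.Tactic.RingSolver using (solve-∀)
open import Data.Product using (Σ; ∃; _×_; _,_; proj₁; proj₂; map₁; map₂)
open import Data.Sum using (inj₁; inj₂)
open import Data.Vec using (Vec; lookup; toList) renaming ([] to []ᵥ; _∷_ to _∷ᵥ_; head to headᵥ)
import Data.Vec.Properties as Vec
open import Function using (_∘_)
open import Function.Bundles using (Equivalence; mk⇔)
open import Relation.Binary.PropositionalEquality hiding ([_])
open import Relation.Nullary using (¬_)

private variable
  A B C : Set

∧-true⁻ : ∀ {a b} → a ∧ b ≡ true → a ≡ true × b ≡ true
∧-true⁻ {true} {true} _ = refl , refl

∧-true⁺ : ∀ {a b} → a ≡ true → b ≡ true → a ∧ b ≡ true
∧-true⁺ refl refl = refl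

≡ᵇ-true⇒≡ : ∀ {x y} → (x ≡ᵇ y) ≡ true → x ≡ y
≡ᵇ-true⇒≡ {x} {y} e = ≡ᵇ⇒≡ x y (Equivalence.from T-≡ e)

≡⇒≡ᵇ-true : ∀ {x y} → x ≡ y → (x ≡ᵇ y) ≡ true
≡⇒≡ᵇ-true {x} {y} e = Equivalence.to T-≡ (≡⇒≡ᵇ x y e)

≢⇒≡ᵇ-false : ∀ {x y} → x ≢ y → (x ≡ᵇ y) ≡ false
≢⇒≡ᵇ-false {x} {y} x≢y with x ≡ᵇ y in e
... | true = ⊥-elim (x≢y (≡ᵇ-true⇒≡ e))
... | false = refl

≡ᵇ-false⇒≢ : ∀ {x y} → (x ≡ᵇ y) ≡ false → x ≢ y
≡ᵇ-false⇒≢ {x} x≢ᵇy refl with () ← trans (sym x≢ᵇy) (≡⇒≡ᵇ-true {x} refl)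

<ᵇ-true⇒< : ∀ {x y} → (x <ᵇ y) ≡ true → x < y
<ᵇ-true⇒< {x} {y} e = <ᵇ⇒< x y (Equivalence.from T-≡ e)

<⇒<ᵇ-true : ∀ {x y} → x < y → (x <ᵇ y) ≡ true
<⇒<ᵇ-true x<y = Equivalence.to T-≡ (<⇒<ᵇ x<y)

countᵇ : (A → Bool) → List A → ℕ
countᵇ p xs = length (filterᵇ p xs)

filterᵇ-∷ : (p : A → Bool) (x : A) (xs : List A) →
  filterᵇ p (x ∷ xs) ≡ (if p x then x ∷ filterᵇ p xs else filterᵇ p xs)
filterᵇ-∷ p x xs with p x
... | true = refl
... | false = refl

∈-filterᵇ⁻ : (p : A → Bool) {x : A} {xs : List A} → x ∈ filterᵇ p xs → x ∈ xs × p x ≡ true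
∈-filterᵇ⁻ p x∈ = map₂ (Equivalence.to T-≡) (∈-filter⁻ (T? ∘ p) x∈)

∈-filterᵇ⁺ : (p : A → Bool) {x : A} {xs : List A} → x ∈ xs → p x ≡ true → x ∈ filterᵇ p xs
∈-filterᵇ⁺ p x∈ px = ∈-filter⁺ (T? ∘ p) x∈ (Equivalence.from T-≡ px)

filterᵇ-cong : (p q : A → Bool) (xs : List A) → (∀ x → x ∈ xs → p x ≡ q x) → filterᵇ p xs ≡ filterᵇ q xs
filterᵇ-cong p q [] _ = refl
filterᵇ-cong p q (x ∷ xs) p≗q
  rewrite filterᵇ-∷ p x xs | filterᵇ-∷ q x xs | p≗q x (here refl)
        | filterᵇ-cong p q xs (λ y y∈ → p≗q y (there y∈)) = refl

countᵇ-cong : (p q : A → Bool) (xs : List A) → (∀ x → x ∈ xs → p x ≡ q x) → countᵇ p xs ≡ countᵇ q xs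
countᵇ-cong p q xs p≗q = cong length (filterᵇ-cong p q xs p≗q)

countᵇ-const : (b : Bool) (xs : List A) → countᵇ (λ _ → b) xs ≡ (if b then length xs else 0)
countᵇ-const false [] = refl
countᵇ-const true [] = refl
countᵇ-const false (x ∷ xs) = countᵇ-const false xs
countᵇ-const true (x ∷ xs) = cong suc (countᵇ-const true xs)

countᵇ-map : (p : B → Bool) (f : A → B) (xs : List A) → countᵇ p (map f xs) ≡ countᵇ (p ∘ f) xs
countᵇ-map p f [] = refl
countᵇ-map p f (x ∷ xs) rewrite filterᵇ-∷ p (f x) (map f xs) | filterᵇ-∷ (p ∘ f) x xs with p (f x)
... | true = cong suc (countᵇ-map p f xs)
... | false = countᵇ-map p f xs

countᵇ-++ : (p : A → Bool) (xs ys : List A) → countᵇ p (xs ++ ys) ≡ countᵇ p xs + countᵇ p ys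
countᵇ-++ p xs ys = trans (cong length (filter-++ (T? ∘ p) xs ys)) (length-++ (filterᵇ p xs))

countᵇ-filterᵇ : (p q : A → Bool) (xs : List A) → countᵇ p (filterᵇ q xs) ≡ countᵇ (λ x → q x ∧ p x) xs
countᵇ-filterᵇ p q [] = refl
countᵇ-filterᵇ p q (x ∷ xs) rewrite filterᵇ-∷ q x xs | filterᵇ-∷ (λ x → q x ∧ p x) x xs with q x
... | false = countᵇ-filterᵇ p q xs
... | true rewrite filterᵇ-∷ p x (filterᵇ q xs) with p x
...   | true = cong suc (countᵇ-filterᵇ p q xs)
...   | false = countᵇ-filterᵇ p q xs

sumBy : (A → ℕ) → List A → ℕ
sumBy f [] = 0
sumBy f (x ∷ xs) = f x + sumBy f xs

sumBy-cong : (f g : A → ℕ) (xs : List A) → (∀ x → x ∈ xs → f x ≡ g x) → sumBy f xs ≡ sumBy g xs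
sumBy-cong f g [] _ = refl
sumBy-cong f g (x ∷ xs) f≗g = cong₂ _+_ (f≗g x (here refl)) (sumBy-cong f g xs (λ y y∈ → f≗g y (there y∈)))

sumBy-+ : (f g : A → ℕ) (xs : List A) → sumBy (λ x → f x + g x) xs ≡ sumBy f xs + sumBy g xs
sumBy-+ f g [] = refl
sumBy-+ f g (x ∷ xs) rewrite sumBy-+ f g xs = interchange (f x) (g x) (sumBy f xs) (sumBy g xs)
  where
  interchange : ∀ a b c d → a + b + (c + d) ≡ a + c + (b + d)
  interchange = solve-∀

countᵇ-concatMap : (p : B → Bool) (F : A → List B) (xs : List A) →
  countᵇ p (concatMap F xs) ≡ sumBy (λ x → countᵇ p (F x)) xs
countᵇ-concatMap p F [] = refl
countᵇ-concatMap p F (x ∷ xs) =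
  trans (countᵇ-++ p (F x) (concatMap F xs)) (cong₂ _+_ refl (countᵇ-concatMap p F xs))

sumBy-indicator : (cnd : A → Bool) (c e : ℕ) (f : A → ℕ) (xs : List A) →
  (∀ x → x ∈ xs → cnd x ≡ true → f x ≡ e) →
  sumBy (λ x → (if cnd x then c else 0) * f x) xs ≡ c * e * countᵇ cnd xs
sumBy-indicator cnd c e f [] _ = sym (*-zeroʳ (c * e))
sumBy-indicator cnd c e f (x ∷ xs) pinned rewrite filterᵇ-∷ cnd x xs with cnd x in cx
... | false = sumBy-indicator cnd c e f xs (λ y y∈ → pinned y (there y∈))
... | true rewrite pinned x (here refl) cx | sumBy-indicator cnd c e f xs (λ y y∈ → pinned y (there y∈))
  = sym (*-suc (c * e) (countᵇ cnd xs))

unique-map⁺ : (f : A → B) {xs : List A} → (∀ {x y} → x ∈ xs → y ∈ xs → f x ≡ f y → x ≡ y) →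
  Unique xs → Unique (map f xs)
unique-map⁺ f injective [] = []
unique-map⁺ f injective (x∉xs ∷ uxs) =
  All.map⁺ (All.tabulate (λ y∈ fx≡fy → All.lookup x∉xs y∈ (injective (here refl) (there y∈) fx≡fy)))
  ∷ unique-map⁺ f (λ x∈ y∈ → injective (there x∈) (there y∈)) uxs

length-unique-≡ : {xs ys : List A} → Unique xs → Unique ys →
  (∀ {z} → z ∈ xs → z ∈ ys) → (∀ {z} → z ∈ ys → z ∈ xs) → length xs ≡ length ys
length-unique-≡ ux uy to from = ↭-length (∼bag⇒↭ (unique∧set⇒bag ux uy (mk⇔ to from)))

all-map⁺ : {P : B → Set} {f : A → B} → (∀ a → P (f a)) → (xs : List A) → All P (map f xs)
all-map⁺ Pf xs = All.map⁺ (All.universal Pf xs)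

all-concatMap⁺ : {P : B → Set} {F : A → List B} → (∀ a → All P (F a)) → (xs : List A) → All P (concatMap F xs)
all-concatMap⁺ PF xs = All.concat⁺ (all-map⁺ PF xs)

disjoint-by : (f : A → C) {c c′ : C} {xs ys : List A} →
  c ≢ c′ → All (λ x → f x ≡ c) xs → All (λ y → f y ≡ c′) ys → Disjoint xs ys
disjoint-by f c≢c′ fxs fys (v∈xs , v∈ys) = c≢c′ (trans (sym (All.lookup fxs v∈xs)) (All.lookup fys v∈ys))

disjoint-++ʳ : {xs ys zs : List A} → Disjoint xs ys → Disjoint xs zs → Disjoint xs (ys ++ zs)
disjoint-++ʳ {ys = ys} dys dzs (v∈xs , v∈ys++zs) with ∈-++⁻ ys v∈ys++zs
... | inj₁ v∈ys = dys (v∈xs , v∈ys)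
... | inj₂ v∈zs = dzs (v∈xs , v∈zs)

∈-concatMap⁺′ : (F : A → List B) {x : A} {xs : List A} {y : B} → x ∈ xs → y ∈ F x → y ∈ concatMap F xs
∈-concatMap⁺′ F x∈ y∈ = ∈-concatMap⁺ F (lose x∈ y∈)

∈-concatMap⁻′ : (F : A → List B) (xs : List A) {y : B} → y ∈ concatMap F xs → ∃ λ x → x ∈ xs × y ∈ F x
∈-concatMap⁻′ F xs y∈ = find (∈-concatMap⁻ F {xs = xs} y∈)

-- key recovers the block an element comes from, so the blocks of distinct a are disjoint.
unique-concatMap : (key : B → Maybe A) (F : A → List B) {xs : List A} →
  (∀ a → All (λ z → key z ≡ just a) (F a)) → (∀ a → Unique (F a)) → Unique xs → Unique (concatMap F xs)
unique-concatMap key F tagged uF [] = []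
unique-concatMap key F {x ∷ xs} tagged uF (x∉xs ∷ uxs) =
  Unique.++⁺ (uF x) (unique-concatMap key F tagged uF uxs) disjoint
  where
  disjoint : Disjoint (F x) (concatMap F xs)
  disjoint (z∈Fx , z∈rest) with ∈-concatMap⁻′ F xs z∈rest
  ... | a , a∈xs , z∈Fa = All.lookup x∉xs a∈xs
    (just-injective (trans (sym (All.lookup (tagged x) z∈Fx)) (All.lookup (tagged a) z∈Fa)))

unique-vecs : (m : ℕ) {xs : List A} → Unique xs → Unique (vecs m xs)
unique-vecs zero _ = [] ∷ []
unique-vecs (suc m) {xs} uxs = unique-concatMap (just ∘ headᵥ) (λ x → map (x ∷ᵥ_) (vecs m xs))
  (λ a → all-map⁺ (λ _ → refl) (vecs m xs)) (λ a → Unique.map⁺ Vec.∷-injectiveʳ (unique-vecs m uxs)) uxs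

∈-vecs⁻ : (m : ℕ) (xs : List A) {v : Vec A m} → v ∈ vecs m xs → All (_∈ xs) (toList v)
∈-vecs⁻ zero xs {[]ᵥ} _ = []
∈-vecs⁻ (suc m) xs v∈ with ∈-concatMap⁻′ (λ x → map (x ∷ᵥ_) (vecs m xs)) xs v∈
... | a , a∈xs , v∈block with ∈-map⁻ (a ∷ᵥ_) v∈block
...   | w , w∈ , refl = a∈xs ∷ ∈-vecs⁻ m xs w∈

∈-vecs⁺ : (m : ℕ) (xs : List A) (v : Vec A m) → All (_∈ xs) (toList v) → v ∈ vecs m xs
∈-vecs⁺ zero xs []ᵥ _ = here refl
∈-vecs⁺ (suc m) xs (x ∷ᵥ v) (x∈ ∷ v⊆) =
  ∈-concatMap⁺′ (λ x → map (x ∷ᵥ_) (vecs m xs)) x∈ (∈-map⁺ (x ∷ᵥ_) (∈-vecs⁺ m xs v v⊆))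

module _ (n : ℕ) where
  private
    fs : List (Fin n)
    fs = allFin n
    singletons pairs triples : List (List (Fin n))
    singletons = map [_] fs
    pairs = concatMap (λ a → map (λ b → a ∷ b ∷ []) fs) fs
    triples = concatMap (λ a → concatMap (λ b → map (λ c → a ∷ b ∷ c ∷ []) fs) fs) fs

    lengths₀ : All (λ (l : List (Fin n)) → length l ≡ 0) ([] ∷ [])
    lengths₀ = refl ∷ []
    lengths₁ : All (λ l → length l ≡ 1) singletons
    lengths₁ = all-map⁺ (λ _ → refl) fs
    lengths₂ : All (λ l → length l ≡ 2) pairs
    lengths₂ = all-concatMap⁺ (λ _ → all-map⁺ (λ _ → refl) fs) fs
    lengths₃ : All (λ l → length l ≡ 3) triples
    lengths₃ = all-concatMap⁺ (λ _ → all-concatMap⁺ (λ _ → all-map⁺ (λ _ → refl) fs) fs) fs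

    at-most-3 : ∀ {k} {ls : List (List (Fin n))} → k ≤ 3 →
      All (λ l → length l ≡ k) ls → All (λ l → length l ≤ 3) ls
    at-most-3 k≤3 = All.map (λ e → subst (_≤ 3) (sym e) k≤3)

  unique-lists≤3 : Unique (lists≤3 n)
  unique-lists≤3 =
    Unique.++⁺ ([] ∷ [])
      (Unique.++⁺ unique₁ (Unique.++⁺ unique₂ unique₃ (disjoint-by length (λ ()) lengths₂ lengths₃))
        (disjoint-++ʳ (disjoint-by length (λ ()) lengths₁ lengths₂) (disjoint-by length (λ ()) lengths₁ lengths₃)))
      (disjoint-++ʳ (disjoint-by length (λ ()) lengths₀ lengths₁)
        (disjoint-++ʳ (disjoint-by length (λ ()) lengths₀ lengths₂) (disjoint-by length (λ ()) lengths₀ lengths₃)))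
    where
    unique-fs : Unique fs
    unique-fs = Unique.allFin⁺ n
    unique₁ : Unique singletons
    unique₁ = Unique.map⁺ ∷-injectiveˡ unique-fs
    unique₂ : Unique pairs
    unique₂ = unique-concatMap head _ (λ _ → all-map⁺ (λ _ → refl) fs)
      (λ _ → Unique.map⁺ (∷-injectiveˡ ∘ ∷-injectiveʳ) unique-fs) unique-fs
    unique₃ : Unique triples
    unique₃ = unique-concatMap head _ (λ _ → all-concatMap⁺ (λ _ → all-map⁺ (λ _ → refl) fs) fs)
      (λ _ → unique-concatMap (head ∘ drop 1) _ (λ _ → all-map⁺ (λ _ → refl) fs)
        (λ _ → Unique.map⁺ (∷-injectiveˡ ∘ ∷-injectiveʳ ∘ ∷-injectiveʳ) unique-fs) unique-fs)
      unique-fs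

  ∈-lists≤3⁻ : {l : List (Fin n)} → l ∈ lists≤3 n → length l ≤ 3
  ∈-lists≤3⁻ = All.lookup (z≤n ∷ All.++⁺ (at-most-3 (s≤s z≤n) lengths₁)
    (All.++⁺ (at-most-3 (s≤s (s≤s z≤n)) lengths₂) (at-most-3 ≤-refl lengths₃)))

  ∈-lists≤3⁺ : (l : List (Fin n)) → length l ≤ 3 → l ∈ lists≤3 n
  ∈-lists≤3⁺ [] _ = here refl
  ∈-lists≤3⁺ (a ∷ []) _ = there (∈-++⁺ˡ (∈-map⁺ [_] (∈-allFin a)))
  ∈-lists≤3⁺ (a ∷ b ∷ []) _ = there (∈-++⁺ʳ singletons (∈-++⁺ˡ
    (∈-concatMap⁺′ (λ a → map (λ b → a ∷ b ∷ []) fs) (∈-allFin a) (∈-map⁺ (λ b → a ∷ b ∷ []) (∈-allFin b)))))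
  ∈-lists≤3⁺ (a ∷ b ∷ c ∷ []) _ = there (∈-++⁺ʳ singletons (∈-++⁺ʳ pairs
    (∈-concatMap⁺′ (λ a → concatMap (λ b → map (λ c → a ∷ b ∷ c ∷ []) fs) fs) (∈-allFin a)
      (∈-concatMap⁺′ (λ b → map (λ c → a ∷ b ∷ c ∷ []) fs) (∈-allFin b)
        (∈-map⁺ (λ c → a ∷ b ∷ c ∷ []) (∈-allFin c))))))
  ∈-lists≤3⁺ (a ∷ b ∷ c ∷ d ∷ l) (s≤s (s≤s (s≤s ())))

-- Position v of a list of child lists stands for the vertex labelled v + 1.  These are the predicates
-- of Defs with labels in ℕ instead of Fin n, so that trees of all sizes share one type.

ChildLists : Set
ChildLists = List (List ℕ)

encode : {N n : ℕ} → Vec (List (Fin N)) n → ChildLists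
encode c = map (map toℕ) (toList c)

occurrences : ℕ → List ℕ → ℕ
occurrences x = countᵇ (_≡ᵇ x)

increasingFrom : ℕ → ChildLists → Bool
increasingFrom k [] = true
increasingFrom k (l ∷ ls) = all (k <ᵇ_) l ∧ increasingFrom (suc k) ls

allFrom : ℕ → ℕ → (ℕ → Bool) → Bool
allFrom k zero g = true
allFrom k (suc n) g = g k ∧ allFrom (suc k) n g

parentCount : ℕ → ℕ
parentCount w = if w ≡ᵇ 0 then 0 else 1

hasParents : ChildLists → Bool
hasParents L = allFrom 0 (length L) (λ w → occurrences w (concat L) ≡ᵇ parentCount w)

isTree : ChildLists → Bool
isTree L = increasingFrom 0 L ∧ hasParents L

degreeCount : ℕ → ChildLists → ℕ
degreeCount d = countᵇ (λ l → length l ≡ᵇ d)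

hasDegrees : ℕ → ℕ → ℕ → ChildLists → Bool
hasDegrees i j k L = (degreeCount 0 L ≡ᵇ k) ∧ (degreeCount 1 L ≡ᵇ j) ∧ (degreeCount 2 L ≡ᵇ i)

encodedCandidates : ℕ → List ChildLists
encodedCandidates n = map encode (candidates n)

allᶠ : (n : ℕ) → (Fin n → Bool) → Bool
allᶠ zero g = true
allᶠ (suc n) g = g fzero ∧ allᶠ n (g ∘ fsuc)

allᶠ-cong : ∀ n (g h : Fin n → Bool) → (∀ v → g v ≡ h v) → allᶠ n g ≡ allᶠ n h
allᶠ-cong zero g h g≗h = refl
allᶠ-cong (suc n) g h g≗h = cong₂ _∧_ (g≗h fzero) (allᶠ-cong n (g ∘ fsuc) (h ∘ fsuc) (g≗h ∘ fsuc))

all-tabulate : ∀ n (f : Fin n → A) (p : A → Bool) → all p (tabulate f) ≡ allᶠ n (p ∘ f)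
all-tabulate zero f p = refl
all-tabulate (suc n) f p = cong (p (f fzero) ∧_) (all-tabulate n (f ∘ fsuc) p)

all-cong : (p q : A → Bool) (xs : List A) → (∀ x → p x ≡ q x) → all p xs ≡ all q xs
all-cong p q [] p≗q = refl
all-cong p q (x ∷ xs) p≗q = cong₂ _∧_ (p≗q x) (all-cong p q xs p≗q)

all-map : (p : B → Bool) (f : A → B) (xs : List A) → all p (map f xs) ≡ all (p ∘ f) xs
all-map p f [] = refl
all-map p f (x ∷ xs) = cong (p (f x) ∧_) (all-map p f xs)

allᶠ-toℕ : ∀ n k (g : ℕ → Bool) → allᶠ n (λ w → g (k + toℕ w)) ≡ allFrom k n g
allᶠ-toℕ zero k g = refl
allᶠ-toℕ (suc n) k g = cong₂ _∧_ (cong g (+-identityʳ k))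
  (trans (allᶠ-cong n _ _ (λ v → cong g (+-suc k (toℕ v)))) (allᶠ-toℕ n (suc k) g))

length-encode : ∀ {N n} (c : Vec (List (Fin N)) n) → length (encode c) ≡ n
length-encode []ᵥ = refl
length-encode (x ∷ᵥ c) = cong suc (length-encode c)

increasingFrom-encode : ∀ {N n} (k : ℕ) (c : Vec (List (Fin N)) n) →
  allᶠ n (λ v → all (λ w → k + toℕ v <ᵇ toℕ w) (lookup c v)) ≡ increasingFrom k (encode c)
increasingFrom-encode k []ᵥ = refl
increasingFrom-encode {n = suc n} k (x ∷ᵥ c) = cong₂ _∧_
  (trans (all-cong _ _ x (λ w → cong (_<ᵇ toℕ w) (+-identityʳ k))) (sym (all-map (k <ᵇ_) toℕ x)))
  (trans (allᶠ-cong n _ _ (λ v → all-cong _ _ (lookup c v) (λ w → cong (_<ᵇ toℕ w) (+-suc k (toℕ v)))))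
         (increasingFrom-encode (suc k) c))

increasingᵇ-encode : ∀ {n} (c : Vec (List (Fin n)) n) → increasingᵇ c ≡ increasingFrom 0 (encode c)
increasingᵇ-encode {n} c = trans (all-tabulate n (λ v → v) _) (increasingFrom-encode 0 c)

parentsᵇ-encode : ∀ {n} (c : Vec (List (Fin n)) n) → parentsᵇ c ≡ hasParents (encode c)
parentsᵇ-encode {n} c = begin
  parentsᵇ c
    ≡⟨ all-tabulate n (λ v → v) _ ⟩
  allᶠ n (λ w → occ w (concat (toList c)) ≡ᵇ parentCount (toℕ w))
    ≡⟨ allᶠ-cong n _ _ (λ w → cong (_≡ᵇ parentCount (toℕ w)) (occ-encode w)) ⟩
  allᶠ n (λ w → g (0 + toℕ w))
    ≡⟨ allᶠ-toℕ n 0 g ⟩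
  allFrom 0 n g
    ≡⟨ cong (λ m → allFrom 0 m g) (sym (length-encode c)) ⟩
  hasParents (encode c) ∎
  where
  open ≡-Reasoning
  g : ℕ → Bool
  g w = occurrences w (concat (encode c)) ≡ᵇ parentCount w
  occ-encode : ∀ w → occ w (concat (toList c)) ≡ occurrences (toℕ w) (concat (encode c))
  occ-encode w = trans (sym (countᵇ-map (_≡ᵇ toℕ w) toℕ (concat (toList c))))
    (cong (occurrences (toℕ w)) (sym (concat-map (toList c))))

degCount-encode : ∀ {n} (d : ℕ) (c : Vec (List (Fin n)) n) → degCount d c ≡ degreeCount d (encode c)
degCount-encode d c = sym (trans (countᵇ-map (λ l → length l ≡ᵇ d) (map toℕ) (toList c))
  (countᵇ-cong _ _ (toList c) (λ l _ → cong (_≡ᵇ d) (length-map toℕ l))))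

γ-encoded : ∀ n i j k → γ n i j k ≡ countᵇ (λ L → isTree L ∧ hasDegrees i j k L) (encodedCandidates n)
γ-encoded n i j k = sym (trans (countᵇ-map _ encode (candidates n))
  (countᵇ-cong _ _ (candidates n) (λ c _ →
     cong₂ _∧_ (sym (cong₂ _∧_ (increasingᵇ-encode c) (parentsᵇ-encode c)))
       (sym (cong₂ (λ a b → (a ≡ᵇ k) ∧ b) (degCount-encode 0 c)
         (cong₂ (λ a b → (a ≡ᵇ j) ∧ (b ≡ᵇ i)) (degCount-encode 1 c) (degCount-encode 2 c)))))))

Bounded : ℕ → List ℕ → Set
Bounded n l = length l ≤ 3 × All (_< n) l

WellFormed : ℕ → ChildLists → Set
WellFormed n L = length L ≡ n × All (Bounded n) L

encode-injective : ∀ {N n} {c c′ : Vec (List (Fin N)) n} → encode c ≡ encode c′ → c ≡ c′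
encode-injective {N} {c = c} {c′} e = toList-injective c c′ (map-injective (map-injective toℕ-injective) e)
  where
  toList-injective : ∀ {m} (a b : Vec (List (Fin N)) m) → toList a ≡ toList b → a ≡ b
  toList-injective []ᵥ []ᵥ _ = refl
  toList-injective (x ∷ᵥ a) (y ∷ᵥ b) e = cong₂ _∷ᵥ_ (∷-injectiveˡ e) (toList-injective a b (∷-injectiveʳ e))

unique-encodedCandidates : ∀ n → Unique (encodedCandidates n)
unique-encodedCandidates n = Unique.map⁺ encode-injective (unique-vecs n (unique-lists≤3 n))

encode-bounded : ∀ {N n} (c : Vec (List (Fin N)) n) → All (_∈ lists≤3 N) (toList c) → All (Bounded N) (encode c)
encode-bounded []ᵥ _ = []
encode-bounded {N} (x ∷ᵥ c) (x∈ ∷ c⊆) =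
  (subst (_≤ 3) (sym (length-map toℕ x)) (∈-lists≤3⁻ N x∈) , all-map⁺ toℕ<n x) ∷ encode-bounded c c⊆

∈-encodedCandidates⁻ : ∀ n {L} → L ∈ encodedCandidates n → WellFormed n L
∈-encodedCandidates⁻ n L∈ with ∈-map⁻ encode L∈
... | c , c∈ , refl = length-encode c , encode-bounded c (∈-vecs⁻ n (lists≤3 n) c∈)

decodeList : ∀ {N} (l : List ℕ) → All (_< N) l → Σ (List (Fin N)) (λ l′ → map toℕ l′ ≡ l)
decodeList [] [] = [] , refl
decodeList (x ∷ l) (x< ∷ l<) with decodeList l l<
... | l′ , refl = fromℕ< x< ∷ l′ , cong (_∷ map toℕ l′) (toℕ-fromℕ< x<)

decode : ∀ {N} n (L : ChildLists) → length L ≡ n → All (Bounded N) L →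
  Σ (Vec (List (Fin N)) n) (λ c → All (_∈ lists≤3 N) (toList c) × encode c ≡ L)
decode zero [] refl [] = []ᵥ , [] , refl
decode {N} (suc n) (l ∷ L) refl ((l≤3 , l<) ∷ L-bounded) with decodeList l l< | decode n L refl L-bounded
... | l′ , l′≡ | c , c⊆ , c≡ =
  (l′ ∷ᵥ c) , ∈-lists≤3⁺ N l′ (subst (_≤ 3) (trans (sym (cong length l′≡)) (length-map toℕ l′)) l≤3) ∷ c⊆ ,
  cong₂ _∷_ l′≡ c≡

∈-encodedCandidates⁺ : ∀ n {L} → WellFormed n L → L ∈ encodedCandidates n
∈-encodedCandidates⁺ n {L} (len , bounded) with decode n L len bounded
... | c , c⊆ , refl = ∈-map⁺ encode (∈-vecs⁺ n (lists≤3 n) c c⊆)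

-- Insertion slots

-- A slot of a tree: the child lists before the host vertex, the host's children split at a gap,
-- and the child lists after it.  The vertex inserted there gets the next free label, size Z.
data Slot : Set where
  slot : ChildLists → List ℕ → List ℕ → ChildLists → Slot

base : Slot → ChildLists
base (slot A l r B) = A ++ (l ++ r) ∷ B

size : Slot → ℕ
size (slot A l r B) = length A + suc (length B)

hostDegree : Slot → ℕ
hostDegree (slot A l r B) = length (l ++ r)

growWith : ℕ → Slot → ChildLists
growWith m (slot A l r B) = A ++ (l ++ m ∷ r) ∷ (B ++ [] ∷ [])

grow : Slot → ChildLists
grow Z = growWith (size Z) Z

splits : List ℕ → List (List ℕ × List ℕ)
splits [] = ([] , []) ∷ []
splits (x ∷ xs) = ([] , x ∷ xs) ∷ map (λ (l , r) → (x ∷ l , r)) (splits xs)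

headSlots : List ℕ → ChildLists → List Slot
headSlots l B = if length l ≤ᵇ 2 then map (λ (x , y) → slot [] x y B) (splits l) else []

shiftSlot : List ℕ → Slot → Slot
shiftSlot l (slot A x y B) = slot (l ∷ A) x y B

slots : ChildLists → List Slot
slots [] = []
slots (l ∷ B) = headSlots l B ++ map (shiftSlot l) (slots B)

∈-splits⁻ : ∀ l {p} → p ∈ splits l → proj₁ p ++ proj₂ p ≡ l
∈-splits⁻ [] (here refl) = refl
∈-splits⁻ (x ∷ l) (here refl) = refl
∈-splits⁻ (x ∷ l) (there p∈) with ∈-map⁻ _ p∈
... | q , q∈ , refl = cong (x ∷_) (∈-splits⁻ l q∈)

∈-splits⁺ : ∀ l r → (l , r) ∈ splits (l ++ r)
∈-splits⁺ [] [] = here refl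
∈-splits⁺ [] (x ∷ r) = here refl
∈-splits⁺ (x ∷ l) r = there (∈-map⁺ (λ (l , r) → (x ∷ l , r)) (∈-splits⁺ l r))

length-splits : ∀ l → length (splits l) ≡ suc (length l)
length-splits [] = refl
length-splits (x ∷ l) = cong suc (trans (length-map _ (splits l)) (length-splits l))

unique-splits : ∀ l → Unique (splits l)
unique-splits [] = [] ∷ []
unique-splits (x ∷ l) = all-map⁺ (λ _ ()) (splits l) ∷ Unique.map⁺ cons-injective (unique-splits l)
  where
  cons-injective : ∀ {p q : List ℕ × List ℕ} → (x ∷ proj₁ p , proj₂ p) ≡ (x ∷ proj₁ q , proj₂ q) → p ≡ q
  cons-injective {_ , _} {_ , _} refl = refl

∈-slots⁻ : ∀ L {Z} → Z ∈ slots L → base Z ≡ L × hostDegree Z ≤ 2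
∈-slots⁻ (l ∷ B) Z∈ with ∈-++⁻ (headSlots l B) Z∈
... | inj₂ Z∈shifted with ∈-map⁻ (shiftSlot l) Z∈shifted
...   | slot _ _ _ _ , Z′∈ , refl = map₁ (cong (l ∷_)) (∈-slots⁻ B Z′∈)
∈-slots⁻ (l ∷ B) Z∈ | inj₁ Z∈head with length l ≤ᵇ 2 in l≤2
...   | true with ∈-map⁻ _ Z∈head
...     | p , p∈ , refl = cong (_∷ B) (∈-splits⁻ l p∈) ,
          subst (_≤ 2) (sym (cong length (∈-splits⁻ l p∈))) (≤ᵇ⇒≤ (length l) 2 (Equivalence.from T-≡ l≤2))

∈-slots⁺ : ∀ Z → hostDegree Z ≤ 2 → Z ∈ slots (base Z)
∈-slots⁺ (slot [] l r B) d rewrite Equivalence.to T-≡ (≤⇒≤ᵇ d) =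
  ∈-++⁺ˡ (∈-map⁺ (λ (x , y) → slot [] x y B) (∈-splits⁺ l r))
∈-slots⁺ (slot (a ∷ A) l r B) d = ∈-++⁺ʳ (headSlots a _) (∈-map⁺ (shiftSlot a) (∈-slots⁺ (slot A l r B) d))

unique-slots : ∀ L → Unique (slots L)
unique-slots [] = []
unique-slots (l ∷ B) = Unique.++⁺ unique-head (Unique.map⁺ shift-injective (unique-slots B))
  (disjoint-by (null ∘ before) (λ ()) head-before (all-map⁺ (λ { (slot _ _ _ _) → refl }) (slots B)))
  where
  before : Slot → ChildLists
  before (slot A _ _ _) = A
  shift-injective : ∀ {Z Z′} → shiftSlot l Z ≡ shiftSlot l Z′ → Z ≡ Z′
  shift-injective {slot _ _ _ _} {slot _ _ _ _} refl = refl
  slot-injective : ∀ {p q : List ℕ × List ℕ} →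
    slot [] (proj₁ p) (proj₂ p) B ≡ slot [] (proj₁ q) (proj₂ q) B → p ≡ q
  slot-injective {_ , _} {_ , _} refl = refl
  unique-head : Unique (headSlots l B)
  unique-head with length l ≤ᵇ 2
  ... | true = Unique.map⁺ slot-injective (unique-splits l)
  ... | false = []
  head-before : All (λ Z → null (before Z) ≡ true) (headSlots l B)
  head-before with length l ≤ᵇ 2
  ... | true = all-map⁺ (λ _ → refl) (splits l)
  ... | false = []

-- A host of degree t ≤ 2 offers t + 1 gaps.
slotWeight : (ℕ → Bool) → ℕ → ℕ
slotWeight q t = if t ≤ᵇ 2 then (if q t then suc t else 0) else 0

countᵇ-slots : ∀ q L → countᵇ (q ∘ hostDegree) (slots L) ≡ sumBy (slotWeight q ∘ length) L
countᵇ-slots q [] = refl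
countᵇ-slots q (l ∷ B) = trans (countᵇ-++ (q ∘ hostDegree) (headSlots l B) (map (shiftSlot l) (slots B)))
  (cong₂ _+_ count-head
    (trans (countᵇ-map (q ∘ hostDegree) (shiftSlot l) (slots B))
      (trans (countᵇ-cong _ _ (slots B) (λ { (slot _ _ _ _) _ → refl })) (countᵇ-slots q B))))
  where
  count-head : countᵇ (q ∘ hostDegree) (headSlots l B) ≡ slotWeight q (length l)
  count-head with length l ≤ᵇ 2
  ... | false = refl
  ... | true = begin
    countᵇ (q ∘ hostDegree) (map (λ (x , y) → slot [] x y B) (splits l))
      ≡⟨ countᵇ-map (q ∘ hostDegree) _ (splits l) ⟩
    countᵇ (λ (x , y) → q (length (x ++ y))) (splits l)
      ≡⟨ countᵇ-cong _ (λ _ → q (length l)) (splits l) (λ p p∈ → cong (q ∘ length) (∈-splits⁻ l p∈)) ⟩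
    countᵇ (λ _ → q (length l)) (splits l)
      ≡⟨ countᵇ-const (q (length l)) (splits l) ⟩
    (if q (length l) then length (splits l) else 0)
      ≡⟨ cong (λ s → if q (length l) then s else 0) (length-splits l) ⟩
    (if q (length l) then suc (length l) else 0) ∎
    where open ≡-Reasoning

indicator : Bool → ℕ
indicator b = if b then 1 else 0

degreeCount-∷ : ∀ d l L → degreeCount d (l ∷ L) ≡ indicator (length l ≡ᵇ d) + degreeCount d L
degreeCount-∷ d l L rewrite filterᵇ-∷ (λ l → length l ≡ᵇ d) l L with length l ≡ᵇ d
... | true = refl
... | false = refl

sumBy-length : (h : ℕ → ℕ) → (∀ t → h (3 + t) ≡ 0) → ∀ L →
  sumBy (h ∘ length) L ≡ h 0 * degreeCount 0 L + h 1 * degreeCount 1 L + h 2 * degreeCount 2 L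
sumBy-length h h≥3 [] = sym (zeros (h 0) (h 1) (h 2))
  where
  zeros : ∀ a b c → a * 0 + b * 0 + c * 0 ≡ 0
  zeros = solve-∀
sumBy-length h h≥3 (l ∷ L)
  rewrite degreeCount-∷ 0 l L | degreeCount-∷ 1 l L | degreeCount-∷ 2 l L | sumBy-length h h≥3 L
  = trans (cong₂ _+_ (by-indicators (length l)) refl)
      (collect (h 0) (h 1) (h 2) (indicator (length l ≡ᵇ 0)) (indicator (length l ≡ᵇ 1)) (indicator (length l ≡ᵇ 2))
        (degreeCount 0 L) (degreeCount 1 L) (degreeCount 2 L))
  where
  collect : ∀ a b c e₀ e₁ e₂ x y z →
    a * e₀ + b * e₁ + c * e₂ + (a * x + b * y + c * z) ≡ a * (e₀ + x) + b * (e₁ + y) + c * (e₂ + z)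
  collect = solve-∀
  by-indicators : ∀ t → h t ≡ h 0 * indicator (t ≡ᵇ 0) + h 1 * indicator (t ≡ᵇ 1) + h 2 * indicator (t ≡ᵇ 2)
  by-indicators 0 = select₀ (h 0) (h 1) (h 2)
    where
    select₀ : ∀ a b c → a ≡ a * 1 + b * 0 + c * 0
    select₀ = solve-∀
  by-indicators 1 = select₁ (h 0) (h 1) (h 2)
    where
    select₁ : ∀ a b c → b ≡ a * 0 + b * 1 + c * 0
    select₁ = solve-∀
  by-indicators 2 = select₂ (h 0) (h 1) (h 2)
    where
    select₂ : ∀ a b c → c ≡ a * 0 + b * 0 + c * 1
    select₂ = solve-∀
  by-indicators (suc (suc (suc t))) = trans (h≥3 t) (select₃ (h 0) (h 1) (h 2))
    where
    select₃ : ∀ a b c → 0 ≡ a * 0 + b * 0 + c * 0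
    select₃ = solve-∀

-- Growing a tree at a slot

all-++ : (p : A → Bool) (xs ys : List A) → all p (xs ++ ys) ≡ all p xs ∧ all p ys
all-++ p [] ys = refl
all-++ p (x ∷ xs) ys rewrite all-++ p xs ys with p x
... | true = refl
... | false = refl

increasingFrom-++ : ∀ k xs ys → increasingFrom k (xs ++ ys) ≡ increasingFrom k xs ∧ increasingFrom (k + length xs) ys
increasingFrom-++ k [] ys = cong (λ z → increasingFrom z ys) (sym (+-identityʳ k))
increasingFrom-++ k (x ∷ xs) ys rewrite increasingFrom-++ (suc k) xs ys | +-suc k (length xs) with all (k <ᵇ_) x
... | true = refl
... | false = refl

-- The new label exceeds the host's position, and the appended empty child list is trivially increasing.
increasingFrom-grow : ∀ Z → increasingFrom 0 (grow Z) ≡ increasingFrom 0 (base Z)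
increasingFrom-grow (slot A l r B)
  rewrite increasingFrom-++ 0 A ((l ++ (length A + suc (length B)) ∷ r) ∷ (B ++ [] ∷ []))
        | increasingFrom-++ 0 A ((l ++ r) ∷ B)
        | all-++ (length A <ᵇ_) l ((length A + suc (length B)) ∷ r)
        | all-++ (length A <ᵇ_) l r
        | increasingFrom-++ (suc (length A)) B ([] ∷ [])
        | <⇒<ᵇ-true (m<m+n (length A) {suc (length B)} (s≤s z≤n))
  with increasingFrom 0 A | all (length A <ᵇ_) l | all (length A <ᵇ_) r | increasingFrom (suc (length A)) B
... | true | true | true | true = refl
... | true | true | true | false = refl
... | true | true | false | _ = refl
... | true | false | _ | _ = refl
... | false | _ | _ | _ = refl

allFrom⁻ : ∀ k n g → allFrom k n g ≡ true → ∀ w → w < n → g (k + w) ≡ true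
allFrom⁻ k (suc n) g all-g zero _ = trans (cong g (+-identityʳ k)) (proj₁ (∧-true⁻ {g k} all-g))
allFrom⁻ k (suc n) g all-g (suc w) (s≤s w<n) =
  trans (cong g (+-suc k w)) (allFrom⁻ (suc k) n g (proj₂ (∧-true⁻ {g k} all-g)) w w<n)

allFrom⁺ : ∀ k n g → (∀ w → w < n → g (k + w) ≡ true) → allFrom k n g ≡ true
allFrom⁺ k zero g _ = refl
allFrom⁺ k (suc n) g all-g = ∧-true⁺ (trans (cong g (sym (+-identityʳ k))) (all-g 0 (s≤s z≤n)))
  (allFrom⁺ (suc k) n g (λ w w<n → trans (cong g (sym (+-suc k w))) (all-g (suc w) (s≤s w<n))))

occurrences-∷ : ∀ x y ys → occurrences x (y ∷ ys) ≡ indicator (y ≡ᵇ x) + occurrences x ys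
occurrences-∷ x y ys rewrite filterᵇ-∷ (_≡ᵇ x) y ys with y ≡ᵇ x
... | true = refl
... | false = refl

Fresh : ℕ → ChildLists → Set
Fresh m L = All (m ≢_) (concat L)

occurrences≡0⁻ : ∀ x ys → occurrences x ys ≡ 0 → All (x ≢_) ys
occurrences≡0⁻ x [] _ = []
occurrences≡0⁻ x (y ∷ ys) none rewrite occurrences-∷ x y ys with y ≡ᵇ x in y≠x
... | false = (≡ᵇ-false⇒≢ y≠x ∘ sym) ∷ occurrences≡0⁻ x ys none

occurrences≡0⁺ : ∀ x ys → All (x ≢_) ys → occurrences x ys ≡ 0
occurrences≡0⁺ x [] _ = refl
occurrences≡0⁺ x (y ∷ ys) (x≢y ∷ fresh) rewrite occurrences-∷ x y ys | ≢⇒≡ᵇ-false (x≢y ∘ sym) =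
  occurrences≡0⁺ x ys fresh

occurrences-growWith : ∀ w m Z →
  occurrences w (concat (growWith m Z)) ≡ occurrences w (concat (base Z)) + indicator (m ≡ᵇ w)
occurrences-growWith w m (slot A l r B)
  rewrite sym (concat-++ A ((l ++ m ∷ r) ∷ (B ++ [] ∷ [])))
        | sym (concat-++ A ((l ++ r) ∷ B))
        | countᵇ-++ (_≡ᵇ w) (concat A) ((l ++ m ∷ r) ++ concat (B ++ [] ∷ []))
        | countᵇ-++ (_≡ᵇ w) (concat A) ((l ++ r) ++ concat B)
        | countᵇ-++ (_≡ᵇ w) (l ++ m ∷ r) (concat (B ++ [] ∷ []))
        | countᵇ-++ (_≡ᵇ w) (l ++ r) (concat B)
        | countᵇ-++ (_≡ᵇ w) l (m ∷ r)
        | countᵇ-++ (_≡ᵇ w) l r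
        | occurrences-∷ w m r
        | sym (concat-++ B ([] ∷ []))
        | ++-identityʳ (concat B)
  = move-last (occurrences w (concat A)) (occurrences w l) (indicator (m ≡ᵇ w)) (occurrences w r) (occurrences w (concat B))
  where
  move-last : ∀ a b c d e → a + (b + (c + d) + e) ≡ a + (b + d + e) + c
  move-last = solve-∀

parentCount-size : ∀ Z → parentCount (size Z) ≡ 1
parentCount-size (slot A l r B) rewrite +-suc (length A) (length B) = refl

length-base : ∀ Z → length (base Z) ≡ size Z
length-base (slot A l r B) = length-++ A

length-grow : ∀ Z → length (grow Z) ≡ suc (size Z)
length-grow (slot A l r B) = trans (length-++ A)
  (trans (cong (λ n → length A + suc n) (trans (length-++ B) (+-comm (length B) 1))) (+-suc (length A) _))

bounded⇒fresh : ∀ m L → All (Bounded m) L → Fresh m L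
bounded⇒fresh m [] _ = []
bounded⇒fresh m (l ∷ L) ((_ , l<m) ∷ L-bounded) =
  All.++⁺ (All.map (λ x<m m≡x → <-irrefl (sym m≡x) x<m) l<m) (bounded⇒fresh m L L-bounded)

wellFormed-grow : ∀ Z → WellFormed (size Z) (base Z) → hostDegree Z ≤ 2 → WellFormed (suc (size Z)) (grow Z)
wellFormed-grow Z@(slot A l r B) (_ , bounded) d with All.++⁻ A bounded
... | A-bounded , ((_ , lr<m) ∷ B-bounded) = length-grow Z ,
  All.++⁺ (All.map raise A-bounded)
    ((subst (_≤ 3) (sym (length-++-sucʳ l m r)) (s≤s d) ,
      All.++⁺ (All.map m≤n⇒m≤1+n (All.++⁻ˡ l lr<m)) (≤-refl ∷ All.map m≤n⇒m≤1+n (All.++⁻ʳ l lr<m)))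
     ∷ All.++⁺ (All.map raise B-bounded) ((z≤n , []) ∷ []))
  where
  m : ℕ
  m = size Z
  raise : ∀ {l} → Bounded m l → Bounded (suc m) l
  raise (l≤3 , l<m) = l≤3 , All.map m≤n⇒m≤1+n l<m

size-of-grown : ∀ Z {n} → WellFormed (suc n) (grow Z) → size Z ≡ n
size-of-grown Z (len , _) = suc-injective (trans (sym (length-grow Z)) len)

wellFormed-shrink : ∀ Z → WellFormed (suc (size Z)) (grow Z) → Fresh (size Z) (base Z) →
  WellFormed (size Z) (base Z) × hostDegree Z ≤ 2
wellFormed-shrink Z@(slot A l r B) (_ , bounded) fresh
  with All.++⁻ A bounded | All.++⁻ A (All.concat⁻ {xss = A ++ (l ++ r) ∷ B} fresh)
... | A-bounded , ((host≤3 , host<) ∷ B′-bounded) | A-fresh , (lr-fresh ∷ B-fresh) =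
  (length-base Z ,
   All.++⁺ (All.zipWith lower (A-bounded , A-fresh))
     ((≤-trans (n≤1+n _) host≤3′ ,
       All.++⁺ (All.zipWith below (All.++⁻ˡ l host< , All.++⁻ˡ l lr-fresh))
               (All.zipWith below (All.tail (All.++⁻ʳ l host<) , All.++⁻ʳ l lr-fresh)))
      ∷ All.zipWith lower (All.++⁻ˡ B B′-bounded , B-fresh))) ,
  s≤s⁻¹ host≤3′
  where
  m : ℕ
  m = size Z
  host≤3′ : suc (length (l ++ r)) ≤ 3
  host≤3′ = subst (_≤ 3) (length-++-sucʳ l m r) host≤3
  below : ∀ {x} → x < suc m × m ≢ x → x < m
  below (x<1+m , m≢x) = ≤∧≢⇒< (s≤s⁻¹ x<1+m) (m≢x ∘ sym)
  lower : ∀ {l} → Bounded (suc m) l × All (m ≢_) l → Bounded m l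
  lower ((l≤3 , l<) , l-fresh) = l≤3 , All.zipWith below (l< , l-fresh)

-- The new vertex is a leaf, and exactly one parent lists it because its label is fresh.
isTree-grow : ∀ Z → Fresh (size Z) (base Z) → isTree (base Z) ≡ true → isTree (grow Z) ≡ true
isTree-grow Z fresh tree with ∧-true⁻ {increasingFrom 0 (base Z)} tree
... | increasing , parents = ∧-true⁺ (trans (increasingFrom-grow Z) increasing) grown-parents
  where
  m : ℕ
  m = size Z
  grown-parents : hasParents (grow Z) ≡ true
  grown-parents rewrite length-grow Z = allFrom⁺ 0 (suc m) _ parent-ok
    where
    parent-ok : ∀ w → w < suc m → (occurrences w (concat (grow Z)) ≡ᵇ parentCount w) ≡ true
    parent-ok w w<1+m rewrite occurrences-growWith w m Z with m≤n⇒m<n∨m≡n (s≤s⁻¹ w<1+m)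
    ... | inj₁ w<m rewrite ≢⇒≡ᵇ-false {m} {w} (λ m≡w → <-irrefl (sym m≡w) w<m)
                         | +-identityʳ (occurrences w (concat (base Z)))
      = allFrom⁻ 0 (length (base Z)) _ parents w (subst (w <_) (sym (length-base Z)) w<m)
    ... | inj₂ refl rewrite ≡⇒≡ᵇ-true {m} refl | occurrences≡0⁺ m (concat (base Z)) fresh | parentCount-size Z
      = refl

isTree-shrink : ∀ Z → Fresh (size Z) (base Z) → isTree (grow Z) ≡ true → isTree (base Z) ≡ true
isTree-shrink Z fresh tree with ∧-true⁻ {increasingFrom 0 (grow Z)} tree
... | increasing , parents = ∧-true⁺ (trans (sym (increasingFrom-grow Z)) increasing) base-parents
  where
  m : ℕ
  m = size Z
  base-parents : hasParents (base Z) ≡ true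
  base-parents rewrite length-base Z = allFrom⁺ 0 m _ parent-ok
    where
    parent-ok : ∀ w → w < m → (occurrences w (concat (base Z)) ≡ᵇ parentCount w) ≡ true
    parent-ok w w<m = subst (λ o → (o ≡ᵇ parentCount w) ≡ true) same-count
      (allFrom⁻ 0 (length (grow Z)) _ parents w (subst (w <_) (sym (length-grow Z)) (m≤n⇒m≤1+n w<m)))
      where
      same-count : occurrences w (concat (grow Z)) ≡ occurrences w (concat (base Z))
      same-count rewrite occurrences-growWith w m Z | ≢⇒≡ᵇ-false {m} {w} (λ m≡w → <-irrefl (sym m≡w) w<m)
        = +-identityʳ _

-- Removing the largest vertex

split-at-first : (P : A → Set) {xs xs′ ys ys′ : List A} {y y′ : A} →
  All (¬_ ∘ P) xs → All (¬_ ∘ P) xs′ → P y → P y′ →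
  xs ++ y ∷ ys ≡ xs′ ++ y′ ∷ ys′ → xs ≡ xs′ × y ≡ y′ × ys ≡ ys′
split-at-first P {[]} {[]} _ _ _ _ refl = refl , refl , refl
split-at-first P {[]} {_ ∷ _} _ (¬Py ∷ _) Py _ refl = ⊥-elim (¬Py Py)
split-at-first P {_ ∷ _} {[]} (¬Py′ ∷ _) _ _ Py′ refl = ⊥-elim (¬Py′ Py′)
split-at-first P {_ ∷ _} {_ ∷ _} (_ ∷ ¬Pxs) (_ ∷ ¬Pxs′) Py Py′ e
  with split-at-first P ¬Pxs ¬Pxs′ Py Py′ (∷-injectiveʳ e)
... | xs≡ , y≡ , ys≡ = cong₂ _∷_ (∷-injectiveˡ e) xs≡ , y≡ , ys≡

fresh⇒∉ : {m : ℕ} {l : List ℕ} → All (m ≢_) l → ¬ m ∈ l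
fresh⇒∉ fresh m∈l = All.lookup fresh m∈l refl

-- The grown list determines the host (the only child list containing m) and the gap (the position of m).
growWith-injective : ∀ m Z Z′ → Fresh m (base Z) → Fresh m (base Z′) → growWith m Z ≡ growWith m Z′ → Z ≡ Z′
growWith-injective m (slot A l r B) (slot A′ l′ r′ B′) fresh fresh′ e
  with All.++⁻ A (All.concat⁻ {xss = A ++ (l ++ r) ∷ B} fresh)
     | All.++⁻ A′ (All.concat⁻ {xss = A′ ++ (l′ ++ r′) ∷ B′} fresh′)
... | A-fresh , (lr-fresh ∷ _) | A′-fresh , (lr′-fresh ∷ _)
  with split-at-first (m ∈_) (All.map fresh⇒∉ A-fresh) (All.map fresh⇒∉ A′-fresh)
         (∈-++⁺ʳ l (here refl)) (∈-++⁺ʳ l′ (here refl)) e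
... | refl , host≡ , B≡
  with split-at-first (m ≡_) (All.++⁻ˡ l lr-fresh) (All.++⁻ˡ l′ lr′-fresh) refl refl host≡
... | refl , _ , refl with ++-cancelʳ ([] ∷ []) B B′ B≡
... | refl = refl

grow-injective : ∀ Z Z′ → Fresh (size Z) (base Z) → Fresh (size Z′) (base Z′) → grow Z ≡ grow Z′ → Z ≡ Z′
grow-injective Z Z′ fresh fresh′ e with suc-injective (trans (sym (length-grow Z)) (trans (cong length e) (length-grow Z′)))
... | size≡ = growWith-injective (size Z) Z Z′ fresh (subst (λ m → Fresh m (base Z′)) (sym size≡) fresh′)
  (trans e (cong (λ m → growWith m Z′) (sym size≡)))

split-at-occurrence : ∀ x ys → occurrences x ys ≡ 1 →
  Σ (List ℕ) λ l → Σ (List ℕ) λ r → ys ≡ l ++ x ∷ r × All (x ≢_) l × All (x ≢_) r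
split-at-occurrence x (y ∷ ys) once rewrite occurrences-∷ x y ys with y ≡ᵇ x in y≟x
... | true = [] , ys , cong (_∷ ys) (≡ᵇ-true⇒≡ y≟x) , [] , occurrences≡0⁻ x ys (suc-injective once)
... | false with split-at-occurrence x ys once
...   | l , r , refl , l-fresh , r-fresh = y ∷ l , r , refl , (≡ᵇ-false⇒≢ y≟x ∘ sym) ∷ l-fresh , r-fresh

split-at-occurrenceᴸ : ∀ x L → occurrences x (concat L) ≡ 1 →
  Σ ChildLists λ A → Σ (List ℕ) λ X → Σ ChildLists λ B →
    L ≡ A ++ X ∷ B × occurrences x (concat A) ≡ 0 × occurrences x X ≡ 1 × occurrences x (concat B) ≡ 0
split-at-occurrenceᴸ x (Y ∷ L) once rewrite countᵇ-++ (_≡ᵇ x) Y (concat L) with occurrences x Y in inY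
... | 0 with split-at-occurrenceᴸ x L once
...   | A , X , B , refl , none-in-A , once-in-X , none-in-B =
  Y ∷ A , X , B , refl , trans (countᵇ-++ (_≡ᵇ x) Y (concat A)) (cong₂ _+_ inY none-in-A) , once-in-X , none-in-B
split-at-occurrenceᴸ x (Y ∷ L) once | 1 = [] , Y , L , refl , refl , inY , suc-injective once

slot-at-occurrence : ∀ x L → occurrences x (concat L) ≡ 1 →
  Σ Slot λ Z → growWith x Z ≡ L ++ [] ∷ [] × Fresh x (base Z) × size Z ≡ length L
slot-at-occurrence x L once with split-at-occurrenceᴸ x L once
... | A , X , B , refl , none-in-A , once-in-X , none-in-B with split-at-occurrence x X once-in-X
...   | l , r , refl , l-fresh , r-fresh =
  slot A l r B , sym (++-assoc A ((l ++ x ∷ r) ∷ B) ([] ∷ [])) ,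
  subst (All (x ≢_)) (concat-++ A ((l ++ r) ∷ B))
    (All.++⁺ (occurrences≡0⁻ x (concat A) none-in-A)
      (All.++⁺ (All.++⁺ l-fresh r-fresh) (occurrences≡0⁻ x (concat B) none-in-B))) ,
  sym (length-++ A)

last-childless : ∀ n x → All (_< suc n) x → all (n <ᵇ_) x ≡ true → x ≡ []
last-childless n [] _ _ = refl
last-childless n (y ∷ ys) (y<1+n ∷ _) above =
  ⊥-elim (<-irrefl refl (≤-trans (<ᵇ-true⇒< (proj₁ (∧-true⁻ {n <ᵇ y} above))) (s≤s⁻¹ y<1+n)))

length-∷ʳ⁻ : (xs : List A) (x : A) {n : ℕ} → length (xs ∷ʳ x) ≡ suc n → length xs ≡ n
length-∷ʳ⁻ xs x len = trans (sym (cong length (++-identityʳ xs))) (suc-injective (trans (sym (length-++-sucʳ xs x [])) len))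

occurrences-last-label : ∀ m L₀ → length (L₀ ∷ʳ []) ≡ suc (suc m) → hasParents (L₀ ∷ʳ []) ≡ true →
  occurrences (suc m) (concat L₀) ≡ 1
occurrences-last-label m L₀ len parents =
  trans (cong (occurrences (suc m)) (trans (sym (++-identityʳ (concat L₀))) (concat-++ L₀ ([] ∷ []))))
    (≡ᵇ-true⇒≡ (allFrom⁻ 0 (length (L₀ ∷ʳ [])) _ parents (suc m) (subst (suc m <_) (sym len) ≤-refl)))

-- In a tree on m + 2 vertices the last vertex is a leaf listed once, which pins down the slot it grew from.
shrink : ∀ m L → WellFormed (suc (suc m)) L → isTree L ≡ true → Σ Slot λ Z → grow Z ≡ L × Fresh (size Z) (base Z)
shrink m L wf tree with initLast L
... | L₀ ∷ʳ′ x = shrink-∷ʳ L₀ x wf tree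
  where
  shrink-∷ʳ : ∀ L₀ x → WellFormed (suc (suc m)) (L₀ ∷ʳ x) → isTree (L₀ ∷ʳ x) ≡ true →
    Σ Slot λ Z → grow Z ≡ L₀ ∷ʳ x × Fresh (size Z) (base Z)
  shrink-∷ʳ L₀ x (len , bounded) tree
    with ∧-true⁻ {increasingFrom 0 (L₀ ∷ʳ x)} tree
  ... | increasing , parents
    with last-childless (suc m) x (proj₂ (All.head (All.++⁻ʳ L₀ bounded)))
           (subst (λ k → all (k <ᵇ_) x ≡ true) (length-∷ʳ⁻ L₀ x len)
             (proj₁ (∧-true⁻ (proj₂ (∧-true⁻ {increasingFrom 0 L₀}
               (trans (sym (increasingFrom-++ 0 L₀ (x ∷ []))) increasing))))))
  ... | refl with slot-at-occurrence (suc m) L₀ (occurrences-last-label m L₀ len parents)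
  ... | Z , grown , fresh , size≡ with trans size≡ (length-∷ʳ⁻ L₀ [] len)
  ... | size≡1+m =
    Z , subst (λ k → growWith k Z ≡ _) (sym size≡1+m) grown , subst (λ k → Fresh k (base Z)) (sym size≡1+m) fresh

-- Degree statistics of a grown tree

offHost : ℕ → Slot → ℕ
offHost d (slot A l r B) = degreeCount d A + degreeCount d B

degreeCount-base : ∀ d Z → degreeCount d (base Z) ≡ offHost d Z + indicator (hostDegree Z ≡ᵇ d)
degreeCount-base d (slot A l r B) =
  trans (countᵇ-++ _ A _) (trans (cong₂ _+_ refl (degreeCount-∷ d (l ++ r) B))
    (reorder (degreeCount d A) (indicator (length (l ++ r) ≡ᵇ d)) (degreeCount d B)))
  where
  reorder : ∀ a x b → a + (x + b) ≡ a + b + x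
  reorder = solve-∀

-- Growing raises the host's degree by one and adds a leaf.
degreeCount-grow : ∀ d Z →
  degreeCount d (grow Z) ≡ offHost d Z + (indicator (suc (hostDegree Z) ≡ᵇ d) + indicator (0 ≡ᵇ d))
degreeCount-grow d Z@(slot A l r B) =
  trans (countᵇ-++ _ A _)
  (trans (cong₂ _+_ refl (trans (degreeCount-∷ d (l ++ size Z ∷ r) (B ++ [] ∷ []))
     (cong₂ _+_ (cong (λ n → indicator (n ≡ᵇ d)) (length-++-sucʳ l (size Z) r))
        (trans (countᵇ-++ _ B ([] ∷ [])) (cong₂ _+_ refl (degreeCount-∷ d [] []))))))
   (reorder (degreeCount d A) (indicator (suc (length (l ++ r)) ≡ᵇ d)) (degreeCount d B) (indicator (0 ≡ᵇ d))))
  where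
  reorder : ∀ a x b y → a + (x + (b + (y + 0))) ≡ a + b + (x + y)
  reorder = solve-∀

-- grownHas i j k d₀ d₁ d₂ t: a tree with d₀ leaves, d₁ vertices of degree one and d₂ of degree two,
-- grown at a host of degree t, has k leaves, j vertices of degree one and i of degree two.
grownHas : ℕ → ℕ → ℕ → ℕ → ℕ → ℕ → ℕ → Bool
grownHas i j k d₀ d₁ d₂ 0 = (d₀ ≡ᵇ k) ∧ (suc d₁ ≡ᵇ j) ∧ (d₂ ≡ᵇ i)
grownHas i j k d₀ d₁ d₂ 1 = (suc d₀ ≡ᵇ k) ∧ (d₁ ≡ᵇ suc j) ∧ (suc d₂ ≡ᵇ i)
grownHas i j k d₀ d₁ d₂ 2 = (suc d₀ ≡ᵇ k) ∧ (d₁ ≡ᵇ j) ∧ (d₂ ≡ᵇ suc i)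
grownHas i j k d₀ d₁ d₂ _ = false

grownHasᴸ : ℕ → ℕ → ℕ → ChildLists → ℕ → Bool
grownHasᴸ i j k L = grownHas i j k (degreeCount 0 L) (degreeCount 1 L) (degreeCount 2 L)

grownHas-correct : ∀ i j k t → t ≤ 2 → ∀ a₀ a₁ a₂ →
  ((a₀ + (indicator (suc t ≡ᵇ 0) + indicator (0 ≡ᵇ 0))) ≡ᵇ k)
    ∧ ((a₁ + (indicator (suc t ≡ᵇ 1) + indicator (0 ≡ᵇ 1))) ≡ᵇ j)
    ∧ ((a₂ + (indicator (suc t ≡ᵇ 2) + indicator (0 ≡ᵇ 2))) ≡ᵇ i)
  ≡ grownHas i j k (a₀ + indicator (t ≡ᵇ 0)) (a₁ + indicator (t ≡ᵇ 1)) (a₂ + indicator (t ≡ᵇ 2)) t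
grownHas-correct i j k 0 _ a₀ a₁ a₂ rewrite +-suc a₁ 0 = refl
grownHas-correct i j k 1 _ a₀ a₁ a₂ rewrite +-suc a₀ 0 | +-suc a₁ 0 | +-suc a₂ 0 = refl
grownHas-correct i j k 2 _ a₀ a₁ a₂ rewrite +-suc a₀ 0 | +-suc a₂ 0 = refl
grownHas-correct i j k (suc (suc (suc _))) (s≤s (s≤s ()))

hasDegrees-grow : ∀ i j k Z → hostDegree Z ≤ 2 → hasDegrees i j k (grow Z) ≡ grownHasᴸ i j k (base Z) (hostDegree Z)
hasDegrees-grow i j k Z d
  rewrite degreeCount-grow 0 Z | degreeCount-grow 1 Z | degreeCount-grow 2 Z
        | degreeCount-base 0 Z | degreeCount-base 1 Z | degreeCount-base 2 Z
  = grownHas-correct i j k (hostDegree Z) d (offHost 0 Z) (offHost 1 Z) (offHost 2 Z)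

countᵇ-grown-slots : ∀ i j k L → countᵇ (hasDegrees i j k ∘ grow) (slots L) ≡
  slotWeight (grownHasᴸ i j k L) 0 * degreeCount 0 L + slotWeight (grownHasᴸ i j k L) 1 * degreeCount 1 L
    + slotWeight (grownHasᴸ i j k L) 2 * degreeCount 2 L
countᵇ-grown-slots i j k L =
  trans (countᵇ-cong _ (grownHasᴸ i j k L ∘ hostDegree) (slots L)
          (λ Z Z∈ → let (base≡ , d) = ∈-slots⁻ L Z∈ in
                     trans (hasDegrees-grow i j k Z d) (cong (λ L′ → grownHasᴸ i j k L′ (hostDegree Z)) base≡)))
  (trans (countᵇ-slots (grownHasᴸ i j k L) L) (sumBy-length (slotWeight (grownHasᴸ i j k L)) (λ _ → refl) L))

trees : ℕ → List ChildLists
trees n = filterᵇ isTree (encodedCandidates n)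

slotsOfTrees : ℕ → List Slot
slotsOfTrees n = concatMap slots (trees n)

grownTrees : ℕ → List ChildLists
grownTrees n = map grow (slotsOfTrees n)

countᵇ-trees : ∀ n i j k → countᵇ (hasDegrees i j k) (trees n) ≡ γ n i j k
countᵇ-trees n i j k = trans (countᵇ-filterᵇ (hasDegrees i j k) isTree (encodedCandidates n)) (sym (γ-encoded n i j k))

∈-slotsOfTrees⁻ : ∀ n {Z} → Z ∈ slotsOfTrees n →
  WellFormed (size Z) (base Z) × size Z ≡ n × isTree (base Z) ≡ true × hostDegree Z ≤ 2
∈-slotsOfTrees⁻ n {Z} Z∈ with ∈-concatMap⁻′ slots (trees n) Z∈
... | L , L∈ , Z∈slots with ∈-filterᵇ⁻ isTree L∈ | ∈-slots⁻ L Z∈slots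
...   | L∈candidates , tree | refl , d with ∈-encodedCandidates⁻ n L∈candidates
...     | wf@(len , _) = subst (λ m → WellFormed m (base Z)) (sym size≡) wf , size≡ , tree , d
  where
  size≡ : size Z ≡ n
  size≡ = trans (sym (length-base Z)) len

∈-slotsOfTrees⁺ : ∀ n {Z} → WellFormed n (base Z) → isTree (base Z) ≡ true → hostDegree Z ≤ 2 → Z ∈ slotsOfTrees n
∈-slotsOfTrees⁺ n {Z} wf tree d =
  ∈-concatMap⁺′ slots (∈-filterᵇ⁺ isTree (∈-encodedCandidates⁺ n wf) tree) (∈-slots⁺ Z d)

unique-grownTrees : ∀ n → Unique (grownTrees n)
unique-grownTrees n = unique-map⁺ grow (λ Z∈ Z′∈ → grow-injective _ _ (fresh Z∈) (fresh Z′∈))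
  (unique-concatMap (just ∘ base) slots (λ L → All.tabulate (cong just ∘ proj₁ ∘ ∈-slots⁻ L)) unique-slots
    (Unique.filter⁺ (T? ∘ isTree) (unique-encodedCandidates n)))
  where
  fresh : ∀ {Z} → Z ∈ slotsOfTrees n → Fresh (size Z) (base Z)
  fresh {Z} Z∈ = bounded⇒fresh (size Z) (base Z) (proj₂ (proj₁ (∈-slotsOfTrees⁻ n Z∈)))

∈-grownTrees⁻ : ∀ n {L} → L ∈ grownTrees n → WellFormed (suc n) L × isTree L ≡ true
∈-grownTrees⁻ n L∈ with ∈-map⁻ grow L∈
... | Z , Z∈ , refl with ∈-slotsOfTrees⁻ n Z∈
... | wf , refl , tree , d = wellFormed-grow Z wf d , isTree-grow Z (bounded⇒fresh (size Z) (base Z) (proj₂ wf)) tree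

∈-grownTrees⁺ : ∀ m {L} → WellFormed (suc (suc m)) L → isTree L ≡ true → L ∈ grownTrees (suc m)
∈-grownTrees⁺ m {L} wf tree with shrink m L wf tree
... | Z , refl , fresh
  with wellFormed-shrink Z (subst (λ n → WellFormed (suc n) (grow Z)) (sym (size-of-grown Z wf)) wf) fresh
... | wf-base , d = ∈-map⁺ grow (∈-slotsOfTrees⁺ (suc m) {Z}
  (subst (λ n → WellFormed n (base Z)) (size-of-grown Z wf) wf-base) (isTree-shrink Z fresh tree) d)

-- Trees on n + 1 vertices are exactly the trees on n vertices grown at one of their slots.
γ-grown : ∀ m i j k → γ (suc (suc m)) i j k ≡ countᵇ (hasDegrees i j k) (grownTrees (suc m))
γ-grown m i j k = trans (γ-encoded (suc (suc m)) i j k)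
  (length-unique-≡ (Unique.filter⁺ (T? ∘ treeWith) (unique-encodedCandidates (suc (suc m))))
                   (Unique.filter⁺ (T? ∘ hasDegrees i j k) (unique-grownTrees (suc m))) shrunk grown)
  where
  treeWith : ChildLists → Bool
  treeWith L = isTree L ∧ hasDegrees i j k L
  shrunk : ∀ {L} → L ∈ filterᵇ treeWith (encodedCandidates (suc (suc m))) →
    L ∈ filterᵇ (hasDegrees i j k) (grownTrees (suc m))
  shrunk {L} L∈ with ∈-filterᵇ⁻ treeWith L∈
  ... | L∈candidates , tree∧degrees with ∧-true⁻ {isTree L} tree∧degrees
  ... | tree , degrees =
    ∈-filterᵇ⁺ (hasDegrees i j k) (∈-grownTrees⁺ m (∈-encodedCandidates⁻ _ L∈candidates) tree) degrees
  grown : ∀ {L} → L ∈ filterᵇ (hasDegrees i j k) (grownTrees (suc m)) →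
    L ∈ filterᵇ treeWith (encodedCandidates (suc (suc m)))
  grown L∈ with ∈-filterᵇ⁻ (hasDegrees i j k) L∈
  ... | L∈grown , degrees with ∈-grownTrees⁻ (suc m) L∈grown
  ... | wf , tree = ∈-filterᵇ⁺ treeWith (∈-encodedCandidates⁺ (suc (suc m)) wf) (∧-true⁺ tree degrees)

pin₀ : ∀ i j k L → grownHasᴸ i j k L 0 ≡ true → degreeCount 0 L ≡ k
pin₀ i j k L holds = ≡ᵇ-true⇒≡ (proj₁ (∧-true⁻ {degreeCount 0 L ≡ᵇ k} holds))

pin₁ : ∀ i j k L → grownHasᴸ i j k L 1 ≡ true → degreeCount 1 L ≡ suc j
pin₁ i j k L holds =
  ≡ᵇ-true⇒≡ (proj₁ (∧-true⁻ {degreeCount 1 L ≡ᵇ suc j} (proj₂ (∧-true⁻ {suc (degreeCount 0 L) ≡ᵇ k} holds))))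

pin₂ : ∀ i j k L → grownHasᴸ i j k L 2 ≡ true → degreeCount 2 L ≡ suc i
pin₂ i j k L holds =
  ≡ᵇ-true⇒≡ (proj₂ (∧-true⁻ {degreeCount 1 L ≡ᵇ j} (proj₂ (∧-true⁻ {suc (degreeCount 0 L) ≡ᵇ k} holds))))

countᵇ-grownTrees : ∀ i j k n → countᵇ (hasDegrees i j k) (grownTrees n) ≡
  1 * k * countᵇ (λ L → grownHasᴸ i j k L 0) (trees n)
  + 2 * suc j * countᵇ (λ L → grownHasᴸ i j k L 1) (trees n)
  + 3 * suc i * countᵇ (λ L → grownHasᴸ i j k L 2) (trees n)
countᵇ-grownTrees i j k n = begin
  countᵇ (hasDegrees i j k) (map grow (concatMap slots T))
    ≡⟨ countᵇ-map (hasDegrees i j k) grow (concatMap slots T) ⟩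
  countᵇ (hasDegrees i j k ∘ grow) (concatMap slots T)
    ≡⟨ countᵇ-concatMap (hasDegrees i j k ∘ grow) slots T ⟩
  sumBy (λ L → countᵇ (hasDegrees i j k ∘ grow) (slots L)) T
    ≡⟨ sumBy-cong _ _ T (λ L _ → countᵇ-grown-slots i j k L) ⟩
  sumBy (λ L → weighted 0 L + weighted 1 L + weighted 2 L) T
    ≡⟨ sumBy-+ (λ L → weighted 0 L + weighted 1 L) (weighted 2) T ⟩
  sumBy (λ L → weighted 0 L + weighted 1 L) T + sumBy (weighted 2) T
    ≡⟨ cong₂ _+_ (sumBy-+ (weighted 0) (weighted 1) T) refl ⟩
  sumBy (weighted 0) T + sumBy (weighted 1) T + sumBy (weighted 2) T
    ≡⟨ cong₂ _+_ (cong₂ _+_ (sumBy-indicator (λ L → grownHasᴸ i j k L 0) 1 k (degreeCount 0) T (λ L _ → pin₀ i j k L))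
                            (sumBy-indicator (λ L → grownHasᴸ i j k L 1) 2 (suc j) (degreeCount 1) T (λ L _ → pin₁ i j k L)))
                 (sumBy-indicator (λ L → grownHasᴸ i j k L 2) 3 (suc i) (degreeCount 2) T (λ L _ → pin₂ i j k L)) ⟩
  1 * k * countᵇ (λ L → grownHasᴸ i j k L 0) T
  + 2 * suc j * countᵇ (λ L → grownHasᴸ i j k L 1) T
  + 3 * suc i * countᵇ (λ L → grownHasᴸ i j k L 2) T ∎
  where
  open ≡-Reasoning
  T : List ChildLists
  T = trees n
  weighted : ℕ → ChildLists → ℕ
  weighted t L = slotWeight (grownHasᴸ i j k L) t * degreeCount t L


countᵇ-none : (p : A → Bool) (xs : List A) → (∀ x → p x ≡ false) → countᵇ p xs ≡ 0
countᵇ-none p xs never = trans (countᵇ-cong p (λ _ → false) xs (λ x _ → never x)) (countᵇ-const false xs)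

∧-∧-false : ∀ a b → a ∧ (b ∧ false) ≡ false
∧-∧-false false b = refl
∧-∧-false true b = ∧-zeroʳ b

-- Each count is γ at the indices the grown tree came from, read as 0 when an index would be negative.
countᵇ-leaf-hosts : ∀ n i j k → countᵇ (λ L → grownHasᴸ i j k L 0) (trees n) ≡ γℤ n (+ i) (+ j -ℤ + 1) (+ k)
countᵇ-leaf-hosts n i zero k = countᵇ-none _ (trees n) (λ L → ∧-zeroʳ (degreeCount 0 L ≡ᵇ k))
countᵇ-leaf-hosts n i (suc j) k = countᵇ-trees n i j k

countᵇ-degree-one-hosts : ∀ n i j k →
  countᵇ (λ L → grownHasᴸ i j k L 1) (trees n) ≡ γℤ n (+ i -ℤ + 1) (+ (j + 1)) (+ k -ℤ + 1)
countᵇ-degree-one-hosts n zero j zero = countᵇ-none _ (trees n) (λ L → refl)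
countᵇ-degree-one-hosts n (suc i) j zero = countᵇ-none _ (trees n) (λ L → refl)
countᵇ-degree-one-hosts n zero j (suc k) =
  countᵇ-none _ (trees n) (λ L → ∧-∧-false (degreeCount 0 L ≡ᵇ k) (degreeCount 1 L ≡ᵇ suc j))
countᵇ-degree-one-hosts n (suc i) j (suc k) rewrite +-comm j 1 = countᵇ-trees n i (suc j) k

countᵇ-degree-two-hosts : ∀ n i j k →
  countᵇ (λ L → grownHasᴸ i j k L 2) (trees n) ≡ γℤ n (+ (i + 1)) (+ j) (+ k -ℤ + 1)
countᵇ-degree-two-hosts n i j zero = countᵇ-none _ (trees n) (λ L → refl)
countᵇ-degree-two-hosts n i j (suc k) rewrite +-comm i 1 = countᵇ-trees n (suc i) j k

γ-recurrence : ∀ m i j k → γ (suc (suc m)) i j k ≡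
  3 * (i + 1) * γℤ (suc m) (+ (i + 1)) (+ j) (+ k -ℤ + 1)
  + 2 * (j + 1) * γℤ (suc m) (+ i -ℤ + 1) (+ (j + 1)) (+ k -ℤ + 1)
  + k * γℤ (suc m) (+ i) (+ j -ℤ + 1) (+ k)
γ-recurrence m i j k = begin
  γ (suc (suc m)) i j k
    ≡⟨ γ-grown m i j k ⟩
  countᵇ (hasDegrees i j k) (grownTrees (suc m))
    ≡⟨ countᵇ-grownTrees i j k (suc m) ⟩
  1 * k * countᵇ (λ L → grownHasᴸ i j k L 0) (trees (suc m))
  + 2 * suc j * countᵇ (λ L → grownHasᴸ i j k L 1) (trees (suc m))
  + 3 * suc i * countᵇ (λ L → grownHasᴸ i j k L 2) (trees (suc m))
    ≡⟨ cong₂ _+_ (cong₂ _+_ (cong (1 * k *_) (countᵇ-leaf-hosts (suc m) i j k))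
                            (cong (2 * suc j *_) (countᵇ-degree-one-hosts (suc m) i j k)))
                 (cong (3 * suc i *_) (countᵇ-degree-two-hosts (suc m) i j k)) ⟩
  1 * k * γ₀ + 2 * suc j * γ₁ + 3 * suc i * γ₂
    ≡⟨ reorder i j k γ₀ γ₁ γ₂ ⟩
  3 * (i + 1) * γ₂ + 2 * (j + 1) * γ₁ + k * γ₀ ∎
  where
  open ≡-Reasoning
  γ₀ γ₁ γ₂ : ℕ
  γ₀ = γℤ (suc m) (+ i) (+ j -ℤ + 1) (+ k)
  γ₁ = γℤ (suc m) (+ i -ℤ + 1) (+ (j + 1)) (+ k -ℤ + 1)
  γ₂ = γℤ (suc m) (+ (i + 1)) (+ j) (+ k -ℤ + 1)
  reorder : ∀ i j k a b c → 1 * k * a + 2 * suc j * b + 3 * suc i * c ≡ 3 * (i + 1) * c + 2 * (j + 1) * b + k * a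
  reorder = solve-∀

γ-one-vertex : ∀ i j k → k ≢ 1 → γ 1 i j k ≡ 0
γ-one-vertex i j zero _ = refl
γ-one-vertex i j (suc zero) k≢1 = ⊥-elim (k≢1 refl)
γ-one-vertex i j (suc (suc k)) _ = refl

mainTheorem4 :
    (γ 1 0 0 1 ≡ 1)
    × (∀ (i j k : ℕ) → k ≢ 1 → γ 1 i j k ≡ 0)
    × (∀ (n i j k : ℕ) → 2 ≤ n →
         γ n i j k ≡
           3 * (i + 1) * γℤ (n ∸ 1) (+ (i + 1)) (+ j) (+ k -ℤ + 1)
           + 2 * (j + 1) * γℤ (n ∸ 1) (+ i -ℤ + 1) (+ (j + 1)) (+ k -ℤ + 1)
           + k * γℤ (n ∸ 1) (+ i) (+ j -ℤ + 1) (+ k))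
mainTheorem4 = refl , γ-one-vertex , λ { (suc (suc m)) i j k (s≤s (s≤s z≤n)) → γ-recurrence m i j k }
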